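{- Let $V$ be a finite set and $\mathfrak f,\mathfrak g:2^V\to\mathbb R_{\ge0}$ with $\mathfrak f(\emptyset)=\mathfrak g(\emptyset)=0$, where $\mathfrak f$ is supermodular and strictly monotone and $\mathfrak g$ is submodular and strictly monotone. Define $\overline{\mathfrak g}(S)=\mathfrak g(V)-\mathfrak g(V\setminus S)$ (supermodular) and $\overline{\mathfrak f}(S)=\mathfrak f(V)-\mathfrak f(V\setminus S)$ (submodular), giving the complementary instance $(V;\overline{\mathfrak g},\overline{\mathfrak f})$. Let $\rho^*$ and $\overline\rho^*$ be the density vectors of $(V;\mathfrak f,\mathfrak g)$ and $(V;\overline{\mathfrak g},\overline{\mathfrak f})$ respectively. Then $\rho^*(u)\cdot\overline\rho^*(u)=1$ for all $u\in V$.
   Context: A set function $h$ is strictly monotone if $A\subsetneq B\Rightarrow h(A)<h(B)$; supermodular if $h(A)+h(B)\le h(A\cap B)+h(A\cup B)$; submodular if the reverse inequality holds. $h(S\mid A):=h(S\cup A)-h(A)$. Density vector of an instance $(V;\mathfrak a,\mathfrak b)$ ($\mathfrak a$ supermodular monotone, $\mathfrak b$ submodular strictly monotone, both vanishing at $\emptyset$): $S_0=\emptyset$; for $i\ge1$, with $S_{<i}=\bigcup_{j<i}S_j$ and $V_i=V\setminus S_{<i}\neq\emptyset$, let $S_i$ be the (unique) inclusion-maximal nonempty $S\subseteq V_i$ maximizing $\mathfrak a(S\mid S_{<i})/\mathfrak b(S\mid S_{<i})$, and for $u\in S_i$ let the density vector's $u$-coordinate be this maximum value; stop when $S_i=V_i$.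 -}

module Defs where

open import Level using (Level; _⊔_; suc)
open import Data.Nat using (ℕ)
open import Data.Fin using (Fin)
open import Data.Fin.Subset using (Subset; _∈_; _⊆_; _⊂_; _∪_; _∩_; ∁; ⊥; ⊤; Nonempty)
open import Data.Product using (_×_)
open import Relation.Nullary using (¬_)
open import Relation.Binary.PropositionalEquality using (_≡_)
open import Relation.Binary.Core using (Rel)
open import Relation.Binary.Structures using (IsTotalOrder)
open import Algebra.Structures using (IsCommutativeRing)

-- An ordered field (the reals are an instance).  The inverse is total,
-- with the axiom only for nonzero arguments (0⁻¹ is unconstrained).
record OrderedField c ℓ₁ ℓ₂ : Set (suc (c ⊔ ℓ₁ ⊔ ℓ₂)) where
  infix  4 _≈_ _≤_ _<_
  infixl 7 _*_ _/_
  infixl 6 _+_ _-_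
  field
    Carrier : Set c
    _≈_     : Rel Carrier ℓ₁
    _≤_     : Rel Carrier ℓ₂
    _+_ _*_ : Carrier → Carrier → Carrier
    -_      : Carrier → Carrier
    0# 1#   : Carrier
    _⁻¹     : Carrier → Carrier
    isCommutativeRing : IsCommutativeRing _≈_ _+_ _*_ -_ 0# 1#
    0≉1       : ¬ (0# ≈ 1#)
    ⁻¹-inverse : ∀ x → ¬ (x ≈ 0#) → (x * (x ⁻¹)) ≈ 1#
    isTotalOrder : IsTotalOrder _≈_ _≤_
    +-mono-≤  : ∀ x y z → x ≤ y → (x + z) ≤ (y + z)
    *-nonneg  : ∀ x y → 0# ≤ x → 0# ≤ y → 0# ≤ (x * y)

  _-_ : Carrier → Carrier → Carrier
  x - y = x + (- y)

  _/_ : Carrier → Carrier → Carrier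
  x / y = x * (y ⁻¹)

  _<_ : Carrier → Carrier → Set (ℓ₁ ⊔ ℓ₂)
  x < y = (x ≤ y) × ¬ (x ≈ y)

module _ {c ℓ₁ ℓ₂ : Level} (F : OrderedField c ℓ₁ ℓ₂) {n : ℕ} where
  open OrderedField F

  SetFun : Set c
  SetFun = Subset n → Carrier

  Supermodular : SetFun → Set ℓ₂
  Supermodular h = ∀ A B → (h A + h B) ≤ (h (A ∩ B) + h (A ∪ B))

  Submodular : SetFun → Set ℓ₂
  Submodular h = ∀ A B → (h (A ∩ B) + h (A ∪ B)) ≤ (h A + h B)

  Monotone : SetFun → Set ℓ₂
  Monotone h = ∀ A B → A ⊆ B → h A ≤ h B

  StrictlyMonotone : SetFun → Set (ℓ₁ ⊔ ℓ₂)
  StrictlyMonotone h = ∀ A B → A ⊂ B → h A < h B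

  cond : SetFun → Subset n → Subset n → Carrier
  cond h S A = h (S ∪ A) - h A

  complementFun : SetFun → SetFun
  complementFun h S = h ⊤ - h (∁ S)

  density : SetFun → SetFun → Subset n → Subset n → Carrier
  density a b A S = cond a S A / cond b S A

  IsDensest : SetFun → SetFun → Subset n → Subset n → Set (ℓ₂)
  IsDensest a b A S =
    Nonempty S × S ⊆ ∁ A ×
    (∀ T → Nonempty T → T ⊆ ∁ A → density a b A T ≤ density a b A S)

  IsMaxDensest : SetFun → SetFun → Subset n → Subset n → Set (ℓ₂)
  IsMaxDensest a b A S =
    IsDensest a b A S × (∀ T → IsDensest a b A T → S ⊆ T → T ≡ S)

  -- Peel a b ρ A : starting with S_{<i} = A, the iterative peeling
  -- procedure assigns to the coordinates of ρ outside A the values given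
  -- by the definition of the density vector.
  data Peel (a b : SetFun) (ρ : Fin n → Carrier) : Subset n → Set (ℓ₁ ⊔ ℓ₂) where
    done : ∀ {A} → A ≡ ⊤ → Peel a b ρ A
    step : ∀ {A} (S : Subset n) → IsMaxDensest a b A S →
           (∀ u → u ∈ S → ρ u ≈ density a b A S) →
           Peel a b ρ (A ∪ S) → Peel a b ρ A

  IsDensityVector : SetFun → SetFun → (Fin n → Carrier) → Set (ℓ₁ ⊔ ℓ₂)
  IsDensityVector a b ρ = Peel a b ρ ⊥

{-# OPTIONS --safe #-}

-- Write e_t = f − t·g, which is supermodular for t ≥ 0.  If S_{<i} has been peeled and S_i is
-- densest with density t, then no superset of S_{<i} does better for e_t than S_{<i}, and by
-- induction along the peeling neither does any subset; so S_{<i} and S_{≤i} both maximise e_t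
-- over all of 2^V.  For the complementary instance, its excess at slope t̄ evaluated at V ∖ X is
-- t̄·f(X) − g(X) up to a constant, so the complements of its two sets around u maximise t̄·f − g.
-- Taking from these maximisers sets X ⊂ Y with u ∈ Y ∖ X and adding the two resulting
-- inequalities with weights t̄ and 1 gives (t̄·t − 1)(g(Y) − g(X)) ≥ 0 for one such pair and ≤ 0
-- for the other; as g(Y) > g(X), t̄·t = 1.

module Submission where

open import Defs
open import Level using (Level; _⊔_)
open import Algebra.Bundles using (CommutativeRing)
open import Data.Nat as ℕ using (ℕ; zero; suc)
open import Data.Nat.Properties using (+-suc)
open import Data.Integer as ℤ using (ℤ; +_; -[1+_]; _⊖_; _◃_; sign; ∣_∣)
import Data.Integer.Properties as ℤ
open import Data.Sign as Sign using (Sign)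
open import Data.Maybe using (Maybe; just; nothing)
open import Data.Fin using (Fin)
open import Data.Fin.Subset using (Subset; _∈_; _∉_; _⊆_; _⊂_; _∪_; _∩_; ∁; ⊥; ⊤; Nonempty)
open import Data.Fin.Subset.Properties
open import Data.Product using (_,_; proj₁; proj₂)
open import Data.Sum using (_⊎_; inj₁; inj₂; [_,_]′)
open import Function using (_∘_)
open import Relation.Nullary using (¬_; yes; no; contradiction)
open import Relation.Binary.Structures using (IsTotalOrder)
import Relation.Binary.PropositionalEquality as ≡
open ≡ using (_≡_)

-- Coefficients in ℤ, mapped into R by the canonical homomorphism: unlike natural-number
-- coefficients they cancel, so identities involving subtraction normalise to equal polynomials.
module IntegerCoefficientSolver {c ℓ : Level} (R : CommutativeRing c ℓ) where
  open CommutativeRing R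
  open import Algebra.Properties.Semiring.Mult.TCOptimised semiring using (_×_; 1+×; ×-homo-+; ×1-homo-*)
  open import Algebra.Properties.Ring ring using (-1*x≈-x)
  open import Algebra.Properties.AbelianGroup +-abelianGroup using (⁻¹-∙-comm)
  open import Algebra.Properties.Group +-group using (⁻¹-involutive; ε⁻¹≈ε)
  open import Algebra.Solver.Ring.AlmostCommutativeRing
  open import Relation.Binary.Reasoning.Setoid setoid

  ⟦_⟧ : ℤ → Carrier
  ⟦ + n ⟧    = n × 1#
  ⟦ -[1+ n ] ⟧ = - (suc n × 1#)

  [1+x]-[1+y]≈x-y : ∀ x y → (1# + x) - (1# + y) ≈ x - y
  [1+x]-[1+y]≈x-y x y = begin
    (1# + x) - (1# + y)     ≈⟨ +-cong (+-comm 1# x) (sym (⁻¹-∙-comm 1# y)) ⟩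
    (x + 1#) + (- 1# - y)   ≈⟨ +-assoc x 1# _ ⟩
    x + (1# + (- 1# - y))   ≈⟨ +-congˡ (sym (+-assoc 1# (- 1#) (- y))) ⟩
    x + ((1# - 1#) - y)     ≈⟨ +-congˡ (+-congʳ (-‿inverseʳ 1#)) ⟩
    x + (0# - y)            ≈⟨ +-congˡ (+-identityˡ (- y)) ⟩
    x - y                   ∎

  ⊖-homo : ∀ m n → ⟦ m ⊖ n ⟧ ≈ m × 1# - n × 1#
  ⊖-homo m       zero    = sym (trans (+-congˡ ε⁻¹≈ε) (+-identityʳ _))
  ⊖-homo zero    (suc n) = sym (+-identityˡ _)
  ⊖-homo (suc m) (suc n) = begin
    ⟦ suc m ⊖ suc n ⟧               ≡⟨ ≡.cong ⟦_⟧ (ℤ.[1+m]⊖[1+n]≡m⊖n m n) ⟩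
    ⟦ m ⊖ n ⟧                       ≈⟨ ⊖-homo m n ⟩
    m × 1# - n × 1#                 ≈⟨ [1+x]-[1+y]≈x-y _ _ ⟨
    (1# + m × 1#) - (1# + n × 1#)   ≈⟨ +-cong (1+× m 1#) (-‿cong (1+× n 1#)) ⟨
    suc m × 1# - suc n × 1#         ∎

  +-homo : ∀ i j → ⟦ i ℤ.+ j ⟧ ≈ ⟦ i ⟧ + ⟦ j ⟧
  +-homo (+ m)      (+ n)      = ×-homo-+ 1# m n
  +-homo (+ m)      -[1+ n ]   = ⊖-homo m (suc n)
  +-homo -[1+ m ]   (+ n)      = trans (⊖-homo n (suc m)) (+-comm _ _)
  +-homo -[1+ m ]   -[1+ n ]   = begin
    - (suc (suc m ℕ.+ n) × 1#)       ≡⟨ ≡.cong (λ k → - (suc k × 1#)) (+-suc m n) ⟨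
    - ((suc m ℕ.+ suc n) × 1#)       ≈⟨ -‿cong (×-homo-+ 1# (suc m) (suc n)) ⟩
    - (suc m × 1# + suc n × 1#)      ≈⟨ ⁻¹-∙-comm _ _ ⟨
    ⟦ -[1+ m ] ⟧ + ⟦ -[1+ n ] ⟧       ∎

  -‿homo : ∀ i → ⟦ ℤ.- i ⟧ ≈ - ⟦ i ⟧
  -‿homo (+ zero)   = sym ε⁻¹≈ε
  -‿homo (+ suc n)  = refl
  -‿homo -[1+ n ]   = sym (⁻¹-involutive _)

  signValue : Sign → Carrier
  signValue Sign.+ = 1#
  signValue Sign.- = - 1#

  ◃-homo : ∀ s n → ⟦ s ◃ n ⟧ ≈ signValue s * n × 1#
  ◃-homo s      zero    = sym (zeroʳ _)
  ◃-homo Sign.+ (suc n) = sym (*-identityˡ _)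
  ◃-homo Sign.- (suc n) = sym (-1*x≈-x _)

  signValue-homo : ∀ s t → signValue (s Sign.* t) ≈ signValue s * signValue t
  signValue-homo Sign.+ t      = sym (*-identityˡ _)
  signValue-homo Sign.- Sign.+ = sym (*-identityʳ _)
  signValue-homo Sign.- Sign.- = sym (trans (-1*x≈-x _) (⁻¹-involutive _))

  ⟦⟧-sign-abs : ∀ i → ⟦ i ⟧ ≈ signValue (sign i) * ∣ i ∣ × 1#
  ⟦⟧-sign-abs i = begin
    ⟦ i ⟧                    ≡⟨ ≡.cong ⟦_⟧ (ℤ.◃-inverse i) ⟨
    ⟦ sign i ◃ ∣ i ∣ ⟧        ≈⟨ ◃-homo (sign i) ∣ i ∣ ⟩
    signValue (sign i) * ∣ i ∣ × 1# ∎

  *-homo : ∀ i j → ⟦ i ℤ.* j ⟧ ≈ ⟦ i ⟧ * ⟦ j ⟧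
  *-homo i j = begin
    ⟦ (sign i Sign.* sign j) ◃ (∣ i ∣ ℕ.* ∣ j ∣) ⟧       ≈⟨ ◃-homo (sign i Sign.* sign j) (∣ i ∣ ℕ.* ∣ j ∣) ⟩
    signValue (sign i Sign.* sign j) * (∣ i ∣ ℕ.* ∣ j ∣) × 1#
      ≈⟨ *-cong (signValue-homo (sign i) (sign j)) (×1-homo-* ∣ i ∣ ∣ j ∣) ⟩
    (s * t) * (m * n)                                  ≈⟨ *-assoc s t _ ⟩
    s * (t * (m * n))                                  ≈⟨ *-congˡ (x∙yz≈y∙xz t m n) ⟩
    s * (m * (t * n))                                  ≈⟨ *-assoc s m _ ⟨
    (s * m) * (t * n)                                  ≈⟨ *-cong (⟦⟧-sign-abs i) (⟦⟧-sign-abs j) ⟨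
    ⟦ i ⟧ * ⟦ j ⟧                                      ∎
    where
    open import Algebra.Properties.CommutativeSemigroup *-commutativeSemigroup using (x∙yz≈y∙xz)
    s = signValue (sign i)
    t = signValue (sign j)
    m = ∣ i ∣ × 1#
    n = ∣ j ∣ × 1#

  homomorphism : ℤ.+-*-rawRing -Raw-AlmostCommutative⟶ fromCommutativeRing R
  homomorphism = record
    { ⟦_⟧    = ⟦_⟧
    ; +-homo = +-homo
    ; *-homo = *-homo
    ; -‿homo = -‿homo
    ; 0-homo = refl
    ; 1-homo = refl
    }

  _≟⟦⟧_ : ∀ i j → Maybe (⟦ i ⟧ ≈ ⟦ j ⟧)
  i ≟⟦⟧ j with i ℤ.≟ j
  ... | yes ≡.refl = just refl
  ... | no _     = nothing

  open import Algebra.Solver.Ring ℤ.+-*-rawRing (fromCommutativeRing R) homomorphism _≟⟦⟧_ public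
    using (solve; _:=_; _:+_; _:*_; _:-_; con)

module OrderedFieldProperties {c ℓ₁ ℓ₂ : Level} (F : OrderedField c ℓ₁ ℓ₂) where
  open OrderedField F

  commutativeRing : CommutativeRing c ℓ₁
  commutativeRing = record { isCommutativeRing = isCommutativeRing }

  open CommutativeRing commutativeRing public
    using (setoid; refl; sym; trans; +-cong; -‿cong; *-cong; *-comm; *-assoc; *-identityʳ; zeroˡ)
  open IsTotalOrder isTotalOrder public using ()
    renaming (refl to ≤-refl; trans to ≤-trans; reflexive to ≤-reflexive;
              antisym to ≤-antisym; total to ≤-total)
  open IntegerCoefficientSolver commutativeRing public
    using (solve; _:=_; _:+_; _:*_; _:-_; con)
  open import Relation.Binary.Reasoning.Setoid setoid

  ≡⇒≤ : ∀ {x y} → x ≡ y → x ≤ y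
  ≡⇒≤ ≡.refl = ≤-refl

  x≤y⇒0≤y-x : ∀ {x y} → x ≤ y → 0# ≤ y - x
  x≤y⇒0≤y-x {x} {y} x≤y = ≤-trans
    (≤-reflexive (solve 1 (λ x → con (+ 0) := x :- x) refl x))
    (+-mono-≤ x y (- x) x≤y)

  ≤-by-difference : ∀ {d x y} → 0# ≤ d → d ≈ y - x → x ≤ y
  ≤-by-difference {d} {x} {y} 0≤d d≈y-x = ≤-trans
    (≤-reflexive (solve 1 (λ x → x := con (+ 0) :+ x) refl x))
    (≤-trans (+-mono-≤ 0# d x 0≤d)
             (≤-reflexive (trans (+-cong d≈y-x refl) (solve 2 (λ x y → (y :- x) :+ x := y) refl x y))))

  +-nonneg : ∀ {x y} → 0# ≤ x → 0# ≤ y → 0# ≤ x + y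
  +-nonneg {x} {y} 0≤x 0≤y = ≤-trans 0≤y
    (≤-trans (≤-reflexive (solve 1 (λ y → y := con (+ 0) :+ y) refl y)) (+-mono-≤ 0# x y 0≤x))

  p+q≤r+s⇒r≤q⇒p≤s : ∀ {p q r s} → p + q ≤ r + s → r ≤ q → p ≤ s
  p+q≤r+s⇒r≤q⇒p≤s {p} {q} {r} {s} p+q≤r+s r≤q = ≤-by-difference
    (+-nonneg (x≤y⇒0≤y-x p+q≤r+s) (x≤y⇒0≤y-x r≤q))
    (solve 4 (λ p q r s → ((r :+ s) :- (p :+ q)) :+ (q :- r) := s :- p) refl p q r s)

  *-monoʳ-≤-nonneg : ∀ {x y z} → 0# ≤ z → x ≤ y → x * z ≤ y * z
  *-monoʳ-≤-nonneg {x} {y} {z} 0≤z x≤y = ≤-by-difference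
    (*-nonneg _ _ (x≤y⇒0≤y-x x≤y) 0≤z)
    (solve 3 (λ x y z → (y :- x) :* z := y :* z :- x :* z) refl x y z)

  x<y⇒0<y-x : ∀ {x y} → x < y → 0# < y - x
  x<y⇒0<y-x {x} {y} (x≤y , x≉y) = x≤y⇒0≤y-x x≤y , λ 0≈y-x → x≉y (begin
    x                ≈⟨ solve 2 (λ x y → x := x :+ (y :- x) :- (y :- x)) refl x y ⟩
    x + (y - x) - (y - x) ≈⟨ +-cong refl (-‿cong (sym 0≈y-x)) ⟩
    x + (y - x) - 0#  ≈⟨ solve 2 (λ x y → x :+ (y :- x) :- con (+ 0) := y) refl x y ⟩
    y                ∎)

  x<y⇒z-y<z-x : ∀ {x y z} → x < y → z - y < z - x
  x<y⇒z-y<z-x {x} {y} {z} (x≤y , x≉y) =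
    ≤-by-difference (x≤y⇒0≤y-x x≤y) (solve 3 (λ x y z → y :- x := (z :- x) :- (z :- y)) refl x y z) ,
    λ z-y≈z-x → x≉y (trans (solve 2 (λ x z → x := z :- (z :- x)) refl x z)
      (trans (+-cong refl (-‿cong (sym z-y≈z-x))) (solve 2 (λ y z → z :- (z :- y) := y) refl y z)))

  0<d⇒d≉0 : ∀ {d} → 0# < d → ¬ (d ≈ 0#)
  0<d⇒d≉0 (_ , 0≉d) d≈0 = 0≉d (sym d≈0)

  0<d⇒0≤c*d⇒0≤c : ∀ {c d} → 0# < d → 0# ≤ c * d → 0# ≤ c
  0<d⇒0≤c*d⇒0≤c {c} {d} 0<d@(0≤d , _) 0≤cd with ≤-total 0# c
  ... | inj₁ 0≤c = 0≤c
  ... | inj₂ c≤0 = ≤-reflexive (sym c≈0)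
    where
    cd≈0 : c * d ≈ 0#
    cd≈0 = ≤-antisym (≤-by-difference (*-nonneg _ _ (x≤y⇒0≤y-x c≤0) 0≤d)
      (solve 2 (λ c d → (con (+ 0) :- c) :* d := con (+ 0) :- c :* d) refl c d)) 0≤cd
    c≈0 : c ≈ 0#
    c≈0 = begin
      c                 ≈⟨ sym (*-identityʳ c) ⟩
      c * 1#            ≈⟨ *-cong refl (sym (⁻¹-inverse d (0<d⇒d≉0 0<d))) ⟩
      c * (d * d ⁻¹)    ≈⟨ sym (*-assoc c d (d ⁻¹)) ⟩
      c * d * d ⁻¹      ≈⟨ *-cong cd≈0 refl ⟩
      0# * d ⁻¹         ≈⟨ zeroˡ (d ⁻¹) ⟩
      0#                ∎

  0≤1 : 0# ≤ 1#
  0≤1 with ≤-total 0# 1#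
  ... | inj₁ 0≤1 = 0≤1
  ... | inj₂ 1≤0 = ≤-trans (*-nonneg _ _ (x≤y⇒0≤y-x 1≤0) (x≤y⇒0≤y-x 1≤0))
    (≤-reflexive (trans (solve 1 (λ o → (con (+ 0) :- o) :* (con (+ 0) :- o) := o :* o) refl 1#)
                        (*-identityʳ 1#)))

  0<d⇒0≤d⁻¹ : ∀ {d} → 0# < d → 0# ≤ d ⁻¹
  0<d⇒0≤d⁻¹ {d} 0<d = 0<d⇒0≤c*d⇒0≤c 0<d
    (≤-trans 0≤1 (≤-reflexive (trans (sym (⁻¹-inverse d (0<d⇒d≉0 0<d))) (*-comm d (d ⁻¹)))))

  0<d⇒x/d*d≈x : ∀ {x d} → 0# < d → x / d * d ≈ x
  0<d⇒x/d*d≈x {x} {d} 0<d = begin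
    x * d ⁻¹ * d      ≈⟨ *-assoc x (d ⁻¹) d ⟩
    x * (d ⁻¹ * d)    ≈⟨ *-cong refl (*-comm (d ⁻¹) d) ⟩
    x * (d * d ⁻¹)    ≈⟨ *-cong refl (⁻¹-inverse d (0<d⇒d≉0 0<d)) ⟩
    x * 1#            ≈⟨ *-identityʳ x ⟩
    x                 ∎

module _ {n : ℕ} where
  open import Algebra.Lattice.Properties.BooleanAlgebra (∪-∩-booleanAlgebra n) public
    using () renaming (¬-involutive to ∁-involutive; deMorgan₁ to ∁-∩; deMorgan₂ to ∁-∪)

  p⊂p∪q : ∀ {x} {p q : Subset n} → x ∉ p → x ∈ q → p ⊂ p ∪ q
  p⊂p∪q {p = p} {q} x∉p x∈q = p⊆p∪q q , _ , q⊆p∪q p q x∈q , x∉p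

  p⊂q∪p : ∀ {x} {p q : Subset n} → x ∉ p → x ∈ q → p ⊂ q ∪ p
  p⊂q∪p {p = p} {q} x∉p x∈q = q⊆p∪q q p , _ , p⊆p∪q p x∈q , x∉p

  p∩∁q∪q≡p∪q : ∀ (p q : Subset n) → p ∩ ∁ q ∪ q ≡ p ∪ q
  p∩∁q∪q≡p∪q p q = begin
    p ∩ ∁ q ∪ q          ≡⟨ ∪-distribʳ-∩ q p (∁ q) ⟩
    (p ∪ q) ∩ (∁ q ∪ q)  ≡⟨ ≡.cong ((p ∪ q) ∩_) (∪-inverseˡ q) ⟩
    (p ∪ q) ∩ ⊤          ≡⟨ ∩-identityʳ (p ∪ q) ⟩
    p ∪ q                ∎
    where open ≡.≡-Reasoning

  p⊆q⇒p≡q⊎p⊂q : ∀ {p q : Subset n} → p ⊆ q → p ≡ q ⊎ p ⊂ q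
  p⊆q⇒p≡q⊎p⊂q {p} {q} p⊆q with p ⊂? q
  ... | yes p⊂q = inj₂ p⊂q
  ... | no  p⊄q = inj₁ (⊆-antisym p⊆q q⊆p)
    where
    q⊆p : q ⊆ p
    q⊆p {x} x∈q with x ∈? p
    ... | yes x∈p = x∈p
    ... | no  x∉p = contradiction ((λ {_} → p⊆q) , x , x∈q , x∉p) p⊄q

module SetFunctions {c ℓ₁ ℓ₂ : Level} (F : OrderedField c ℓ₁ ℓ₂) {n : ℕ} where
  open OrderedField F
  open OrderedFieldProperties F

  strictlyMonotone⇒monotone : ∀ {h} → StrictlyMonotone F h → Monotone F {n} h
  strictlyMonotone⇒monotone {h} h-strict A B A⊆B with p⊆q⇒p≡q⊎p⊂q A⊆B
  ... | inj₁ A≡B = ≡⇒≤ (≡.cong h A≡B)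
  ... | inj₂ A⊂B = proj₁ (h-strict A B A⊂B)

  complementFun-supermodular : ∀ {h} → Submodular F {n} h → Supermodular F (complementFun F h)
  complementFun-supermodular {h} h-sub A B = ≤-by-difference (x≤y⇒0≤y-x h∁-sub)
    (solve 5 (λ H hA hB h∪ h∩ → (hA :+ hB) :- (h∪ :+ h∩)
                := ((H :- h∩) :+ (H :- h∪)) :- ((H :- hA) :+ (H :- hB)))
       refl (h ⊤) (h (∁ A)) (h (∁ B)) (h (∁ (A ∪ B))) (h (∁ (A ∩ B))))
    where
    h∁-sub : h (∁ (A ∪ B)) + h (∁ (A ∩ B)) ≤ h (∁ A) + h (∁ B)
    h∁-sub = ≡.subst₂ (λ X Y → h X + h Y ≤ h (∁ A) + h (∁ B))
      (≡.sym (∁-∪ A B)) (≡.sym (∁-∩ A B)) (h-sub (∁ A) (∁ B))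

  complementFun-submodular : ∀ {h} → Supermodular F {n} h → Submodular F (complementFun F h)
  complementFun-submodular {h} h-super A B = ≤-by-difference (x≤y⇒0≤y-x h∁-super)
    (solve 5 (λ H hA hB h∪ h∩ → (h∪ :+ h∩) :- (hA :+ hB)
                := ((H :- hA) :+ (H :- hB)) :- ((H :- h∩) :+ (H :- h∪)))
       refl (h ⊤) (h (∁ A)) (h (∁ B)) (h (∁ (A ∪ B))) (h (∁ (A ∩ B))))
    where
    h∁-super : h (∁ A) + h (∁ B) ≤ h (∁ (A ∪ B)) + h (∁ (A ∩ B))
    h∁-super = ≡.subst₂ (λ X Y → h (∁ A) + h (∁ B) ≤ h X + h Y)
      (≡.sym (∁-∪ A B)) (≡.sym (∁-∩ A B)) (h-super (∁ A) (∁ B))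

  complementFun-strictlyMonotone : ∀ {h} → StrictlyMonotone F {n} h →
                                   StrictlyMonotone F (complementFun F h)
  complementFun-strictlyMonotone h-strict A B A⊂B =
    x<y⇒z-y<z-x (h-strict (∁ B) (∁ A) (p⊂q⇒∁p⊃∁q A⊂B))

  cond-pos : ∀ {h : SetFun F {n}} {A T} → StrictlyMonotone F h → Nonempty T → T ⊆ ∁ A → 0# < cond F h T A
  cond-pos {A = A} {T} h-strict (x , x∈T) T⊆∁A =
    x<y⇒0<y-x (h-strict A (T ∪ A) (p⊂q∪p (x∈∁p⇒x∉p (T⊆∁A x∈T)) x∈T))

  IsMaximizer : SetFun F {n} → Subset n → Set ℓ₂
  IsMaximizer h M = ∀ X → h X ≤ h M

  supermodular-maximizer : ∀ {h M} → Supermodular F h →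
    (∀ X → h (X ∩ M) ≤ h M) → (∀ X → h (X ∪ M) ≤ h M) → IsMaximizer h M
  supermodular-maximizer {h} {M} h-super below above X =
    ≤-trans (p+q≤r+s⇒r≤q⇒p≤s (h-super X M) (below X)) (above X)

  maximizer-≤-∪ : ∀ {h M} → Supermodular F h → IsMaximizer h M → ∀ X → h X ≤ h (X ∪ M)
  maximizer-≤-∪ {h} {M} h-super M-max X = p+q≤r+s⇒r≤q⇒p≤s (h-super X M) (M-max (X ∩ M))

  excess : SetFun F {n} → SetFun F → Carrier → SetFun F
  excess a b t X = a X - t * b X

  record IsInstance (a b : SetFun F {n}) : Set (ℓ₁ ⊔ ℓ₂) where
    field
      a-supermodular     : Supermodular F a
      a-strictlyMonotone : StrictlyMonotone F a
      b-submodular       : Submodular F b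
      b-strictlyMonotone : StrictlyMonotone F b

  complement-isInstance : ∀ {a b} → IsInstance a b → IsInstance (complementFun F b) (complementFun F a)
  complement-isInstance I = record
    { a-supermodular     = complementFun-supermodular b-submodular
    ; a-strictlyMonotone = complementFun-strictlyMonotone b-strictlyMonotone
    ; b-submodular       = complementFun-submodular a-supermodular
    ; b-strictlyMonotone = complementFun-strictlyMonotone a-strictlyMonotone
    }
    where open IsInstance I

module Peeling {c ℓ₁ ℓ₂ : Level} (F : OrderedField c ℓ₁ ℓ₂) {n : ℕ} {a b : SetFun F {n}}
               (I : SetFunctions.IsInstance F a b) where
  open OrderedField F
  open OrderedFieldProperties F
  open SetFunctions F {n}
  open IsInstance I
  open import Relation.Binary.Reasoning.Setoid setoid

  excess-supermodular : ∀ {t} → 0# ≤ t → Supermodular F (excess a b t)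
  excess-supermodular {t} 0≤t A B = ≤-by-difference
    (+-nonneg (x≤y⇒0≤y-x (a-supermodular A B)) (*-nonneg _ _ 0≤t (x≤y⇒0≤y-x (b-submodular A B))))
    (solve 9 (λ t aA aB a∩ a∪ bA bB b∩ b∪ →
        ((a∩ :+ a∪) :- (aA :+ aB)) :+ t :* ((bA :+ bB) :- (b∩ :+ b∪))
        := ((a∩ :- t :* b∩) :+ (a∪ :- t :* b∪)) :- ((aA :- t :* bA) :+ (aB :- t :* bB)))
      refl t (a A) (a B) (a (A ∩ B)) (a (A ∪ B)) (b A) (b B) (b (A ∩ B)) (b (A ∪ B)))

  excess-≤-lowerSlope : ∀ {s t Z X} → Z ⊆ X → s ≤ t →
                      excess a b t Z ≤ excess a b t X → excess a b s Z ≤ excess a b s X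
  excess-≤-lowerSlope {s} {t} {Z} {X} Z⊆X s≤t eZ≤eX = ≤-by-difference
    (+-nonneg (x≤y⇒0≤y-x eZ≤eX)
              (*-nonneg _ _ (x≤y⇒0≤y-x s≤t) (x≤y⇒0≤y-x (strictlyMonotone⇒monotone b-strictlyMonotone Z X Z⊆X))))
    (solve 6 (λ s t aZ aX bZ bX → ((aX :- t :* bX) :- (aZ :- t :* bZ)) :+ (t :- s) :* (bX :- bZ)
                := (aX :- s :* bX) :- (aZ :- s :* bZ))
       refl s t (a Z) (a X) (b Z) (b X))

  slope-≤ : ∀ {s t X Y} → X ⊂ Y →
            excess a b t Y ≤ excess a b t X → excess a b s X ≤ excess a b s Y → s ≤ t
  slope-≤ {s} {t} {X} {Y} X⊂Y tY≤tX sX≤sY = ≤-by-difference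
    (0<d⇒0≤c*d⇒0≤c (x<y⇒0<y-x (b-strictlyMonotone X Y X⊂Y))
      (≤-trans (+-nonneg (x≤y⇒0≤y-x tY≤tX) (x≤y⇒0≤y-x sX≤sY)) (≤-reflexive
        (solve 6 (λ s t aX aY bX bY → ((aX :- t :* bX) :- (aY :- t :* bY)) :+ ((aY :- s :* bY) :- (aX :- s :* bX))
                    := (t :- s) :* (bY :- bX))
           refl s t (a X) (a Y) (b X) (b Y)))))
    refl

  -- At A = S_{<i}, a slope t admitting such a Y is at most the density of layer i − 1,
  -- for which A is a global maximiser of the excess (see lowerMaximal-step).
  LowerMaximal : Subset n → Set (c ⊔ ℓ₂)
  LowerMaximal A = ∀ t Y → A ⊂ Y → excess a b t A ≤ excess a b t Y →
                   ∀ X → excess a b t (X ∩ A) ≤ excess a b t A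

  lowerMaximal-⊥ : LowerMaximal ⊥
  lowerMaximal-⊥ t _ _ _ X = ≡⇒≤ (≡.cong (excess a b t) (∩-zeroʳ X))

  module Densest {A S : Subset n} (S-densest : IsDensest F a b A S) where
    private
      r = density F a b A S
      S≠⊥ = proj₁ S-densest
      S⊆∁A = proj₁ (proj₂ S-densest)
      S-max = proj₂ (proj₂ S-densest)
      0<cond-b = cond-pos b-strictlyMonotone S≠⊥ S⊆∁A

    density-nonneg : 0# ≤ r
    density-nonneg = *-nonneg _ _ (proj₁ (cond-pos a-strictlyMonotone S≠⊥ S⊆∁A)) (0<d⇒0≤d⁻¹ 0<cond-b)

    excess-∪-≤-base : ∀ X → excess a b r (X ∪ A) ≤ excess a b r A
    excess-∪-≤-base X = ≡.subst (λ Y → excess a b r Y ≤ excess a b r A) (p∩∁q∪q≡p∪q X A)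
                                (increment-≤ (X ∩ ∁ A) (p∩q⊆q X (∁ A)))
      where
      increment-≤ : ∀ T → T ⊆ ∁ A → excess a b r (T ∪ A) ≤ excess a b r A
      increment-≤ T T⊆∁A with nonempty? T
      ... | no  T=⊥ = ≡⇒≤ (≡.cong (excess a b r) (≡.trans (≡.cong (_∪ A) (Empty-unique T=⊥)) (∪-identityˡ A)))
      ... | yes T≠⊥ = ≤-by-difference (x≤y⇒0≤y-x cond-a≤r*cond-b)
          (solve 5 (λ r aTA aA bTA bA → r :* (bTA :- bA) :- (aTA :- aA)
                      := (aA :- r :* bA) :- (aTA :- r :* bTA))
             refl r (a (T ∪ A)) (a A) (b (T ∪ A)) (b A))
        where
        0<cond-bT = cond-pos b-strictlyMonotone T≠⊥ T⊆∁A
        cond-a≤r*cond-b : cond F a T A ≤ r * cond F b T A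
        cond-a≤r*cond-b = ≤-trans (≤-reflexive (sym (0<d⇒x/d*d≈x 0<cond-bT)))
                                  (*-monoʳ-≤-nonneg (proj₁ 0<cond-bT) (S-max T T≠⊥ T⊆∁A))

    excess-base-≤-∪ : excess a b r A ≤ excess a b r (S ∪ A)
    excess-base-≤-∪ = ≤-by-difference ≤-refl (begin
      0#                                ≈⟨ solve 1 (λ x → con (+ 0) := x :- x) refl (cond F a S A) ⟩
      cond F a S A - cond F a S A       ≈⟨ +-cong refl (-‿cong (sym (0<d⇒x/d*d≈x 0<cond-b))) ⟩
      cond F a S A - r * cond F b S A   ≈⟨ solve 5 (λ r aSA aA bSA bA → (aSA :- aA) :- r :* (bSA :- bA)
                                                      := (aSA :- r :* bSA) :- (aA :- r :* bA))
                                             refl r (a (S ∪ A)) (a A) (b (S ∪ A)) (b A) ⟩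
      excess a b r (S ∪ A) - excess a b r A ∎)

    module _ (A-lowerMaximal : LowerMaximal A) where
      base-maximizer : IsMaximizer (excess a b r) A
      base-maximizer = supermodular-maximizer (excess-supermodular density-nonneg)
        (A-lowerMaximal r (S ∪ A) (p⊂q∪p (x∈∁p⇒x∉p (S⊆∁A (proj₂ S≠⊥))) (proj₂ S≠⊥)) excess-base-≤-∪)
        excess-∪-≤-base

      top-maximizer : IsMaximizer (excess a b r) (A ∪ S)
      top-maximizer X = ≤-trans (base-maximizer X)
        (≤-trans excess-base-≤-∪ (≡⇒≤ (≡.cong (excess a b r) (∪-comm S A))))

      lowerMaximal-step : LowerMaximal (A ∪ S)
      lowerMaximal-step t Y A∪S⊂Y tA∪S≤tY X =
        excess-≤-lowerSlope (p∩q⊆q X (A ∪ S)) (slope-≤ A∪S⊂Y (top-maximizer Y) tA∪S≤tY)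
                            (top-maximizer (X ∩ (A ∪ S)))

  -- lower = S_{<i} and upper = S_{≤i} for the layer S_i containing u.
  record Layer (ρ : Fin n → Carrier) (u : Fin n) : Set (c ⊔ ℓ₁ ⊔ ℓ₂) where
    field
      value           : Carrier
      lower upper     : Subset n
      ρ≈value         : ρ u ≈ value
      value-nonneg    : 0# ≤ value
      u∉lower         : u ∉ lower
      u∈upper         : u ∈ upper
      lower-maximizer : IsMaximizer (excess a b value) lower
      upper-maximizer : IsMaximizer (excess a b value) upper

  layer : ∀ {ρ A} → LowerMaximal A → Peel F a b ρ A → ∀ u → u ∉ A → Layer ρ u
  layer inv (done A≡⊤) u u∉A = contradiction (≡.subst (u ∈_) (≡.sym A≡⊤) ∈⊤) u∉A
  layer {A = A} inv (step S (S-densest , _) ρ≈density rest) u u∉A with u ∈? S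
  ... | yes u∈S = record
    { value           = density F a b A S
    ; lower           = A
    ; upper           = A ∪ S
    ; ρ≈value         = ρ≈density u u∈S
    ; value-nonneg    = density-nonneg
    ; u∉lower         = u∉A
    ; u∈upper         = q⊆p∪q A S u∈S
    ; lower-maximizer = base-maximizer inv
    ; upper-maximizer = top-maximizer inv
    }
    where open Densest S-densest
  ... | no u∉S = layer (Densest.lowerMaximal-step S-densest inv) rest u ([ u∉A , u∉S ]′ ∘ x∈p∪q⁻ A S)

  densityVector-layer : ∀ {ρ} → IsDensityVector F a b ρ → ∀ u → Layer ρ u
  densityVector-layer ρ-peel u = layer lowerMaximal-⊥ ρ-peel u ∉⊥

module Complementation {c ℓ₁ ℓ₂ : Level} (F : OrderedField c ℓ₁ ℓ₂) {n : ℕ} (f g : SetFun F {n}) where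
  open OrderedField F
  open OrderedFieldProperties F
  open SetFunctions F {n}
  open import Relation.Binary.Reasoning.Setoid setoid

  dualExcess : Carrier → SetFun F {n}
  dualExcess s X = s * f X - g X

  dualExcess-supermodular : ∀ {s} → Supermodular F f → Submodular F g → 0# ≤ s →
                            Supermodular F (dualExcess s)
  dualExcess-supermodular {s} f-super g-sub 0≤s A B = ≤-by-difference
    (+-nonneg (*-nonneg _ _ 0≤s (x≤y⇒0≤y-x (f-super A B))) (x≤y⇒0≤y-x (g-sub A B)))
    (solve 9 (λ s fA fB f∩ f∪ gA gB g∩ g∪ →
        s :* ((f∩ :+ f∪) :- (fA :+ fB)) :+ ((gA :+ gB) :- (g∩ :+ g∪))
        := ((s :* f∩ :- g∩) :+ (s :* f∪ :- g∪)) :- ((s :* fA :- gA) :+ (s :* fB :- gB)))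
      refl s (f A) (f B) (f (A ∩ B)) (f (A ∪ B)) (g A) (g B) (g (A ∩ B)) (g (A ∪ B)))

  excess-complement : ∀ s X → excess (complementFun F g) (complementFun F f) s (∁ X)
                              ≈ (g ⊤ - s * f ⊤) + dualExcess s X
  excess-complement s X = begin
    (g ⊤ - g (∁ (∁ X))) - s * (f ⊤ - f (∁ (∁ X)))
      ≡⟨ ≡.cong (λ Z → (g ⊤ - g Z) - s * (f ⊤ - f Z)) (∁-involutive X) ⟩
    (g ⊤ - g X) - s * (f ⊤ - f X)
      ≈⟨ solve 5 (λ s G F gX fX → (G :- gX) :- s :* (F :- fX) := (G :- s :* F) :+ (s :* fX :- gX))
           refl s (g ⊤) (f ⊤) (g X) (f X) ⟩
    (g ⊤ - s * f ⊤) + dualExcess s X ∎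

  complement-maximizer : ∀ {s M} → IsMaximizer (excess (complementFun F g) (complementFun F f) s) M →
                         IsMaximizer (dualExcess s) (∁ M)
  complement-maximizer {s} {M} M-max X = ≤-by-difference (x≤y⇒0≤y-x (M-max (∁ X))) (begin
    excess ḡ f̄ s M - excess ḡ f̄ s (∁ X)
      ≡⟨ ≡.cong (λ Z → excess ḡ f̄ s Z - excess ḡ f̄ s (∁ X)) (≡.sym (∁-involutive M)) ⟩
    excess ḡ f̄ s (∁ (∁ M)) - excess ḡ f̄ s (∁ X)
      ≈⟨ +-cong (excess-complement s (∁ M)) (-‿cong (excess-complement s X)) ⟩
    (C + dualExcess s (∁ M)) - (C + dualExcess s X)
      ≈⟨ solve 3 (λ C y x → (C :+ y) :- (C :+ x) := y :- x) refl C (dualExcess s (∁ M)) (dualExcess s X) ⟩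
    dualExcess s (∁ M) - dualExcess s X ∎)
    where
    ḡ = complementFun F g
    f̄ = complementFun F f
    C = g ⊤ - s * f ⊤

  1≤slope-product : ∀ {s t X Y} → g X < g Y → 0# ≤ s →
    excess f g t Y ≤ excess f g t X → dualExcess s X ≤ dualExcess s Y → 1# ≤ s * t
  1≤slope-product {s} {t} {X} {Y} gX<gY 0≤s tY≤tX sX≤sY = ≤-by-difference
    (0<d⇒0≤c*d⇒0≤c (x<y⇒0<y-x gX<gY)
      (≤-trans (+-nonneg (*-nonneg _ _ 0≤s (x≤y⇒0≤y-x tY≤tX)) (x≤y⇒0≤y-x sX≤sY)) (≤-reflexive
        (solve 6 (λ s t fX fY gX gY →
             s :* ((fX :- t :* gX) :- (fY :- t :* gY)) :+ ((s :* fY :- gY) :- (s :* fX :- gX))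
             := (s :* t :- con (+ 1)) :* (gY :- gX))
           refl s t (f X) (f Y) (g X) (g Y)))))
    refl

  slope-product≤1 : ∀ {s t X Y} → g X < g Y → 0# ≤ s →
    excess f g t X ≤ excess f g t Y → dualExcess s Y ≤ dualExcess s X → s * t ≤ 1#
  slope-product≤1 {s} {t} {X} {Y} gX<gY 0≤s tX≤tY sY≤sX = ≤-by-difference
    (0<d⇒0≤c*d⇒0≤c (x<y⇒0<y-x gX<gY)
      (≤-trans (+-nonneg (*-nonneg _ _ 0≤s (x≤y⇒0≤y-x tX≤tY)) (x≤y⇒0≤y-x sY≤sX)) (≤-reflexive
        (solve 6 (λ s t fX fY gX gY →
             s :* ((fY :- t :* gY) :- (fX :- t :* gX)) :+ ((s :* fX :- gX) :- (s :* fY :- gY))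
             := (con (+ 1) :- s :* t) :* (gY :- gX))
           refl s t (f X) (f Y) (g X) (g Y)))))
    refl

corollary1p10 : {c ℓ₁ ℓ₂ : Level} (F : OrderedField c ℓ₁ ℓ₂) (n : ℕ)
    (f g : Subset n → OrderedField.Carrier F) →
    OrderedField._≈_ F (f ⊥) (OrderedField.0# F) →
    OrderedField._≈_ F (g ⊥) (OrderedField.0# F) →
    (∀ S → OrderedField._≤_ F (OrderedField.0# F) (f S)) →
    (∀ S → OrderedField._≤_ F (OrderedField.0# F) (g S)) →
    Supermodular F f → StrictlyMonotone F f →
    Submodular F g → StrictlyMonotone F g →
    (ρ ρ̄ : Fin n → OrderedField.Carrier F) →
    IsDensityVector F f g ρ →
    IsDensityVector F (complementFun F g) (complementFun F f) ρ̄ →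
    ∀ u → OrderedField._≈_ F (OrderedField._*_ F (ρ u) (ρ̄ u)) (OrderedField.1# F)
corollary1p10 F n f g _ _ _ _ f-super f-strict g-sub g-strict ρ ρ̄ ρ-peel ρ̄-peel u = begin
    ρ u * ρ̄ u  ≈⟨ *-cong L.ρ≈value L̄.ρ≈value ⟩
    r * r̄      ≈⟨ *-comm r r̄ ⟩
    r̄ * r      ≈⟨ ≤-antisym r̄r≤1 1≤r̄r ⟩
    1#         ∎
  where
  open OrderedField F
  open OrderedFieldProperties F
  open SetFunctions F {n}
  open Complementation F f g
  open import Relation.Binary.Reasoning.Setoid setoid
  I : IsInstance f g
  I = record { a-supermodular = f-super ; a-strictlyMonotone = f-strict
             ; b-submodular = g-sub ; b-strictlyMonotone = g-strict }
  module P = Peeling F I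
  module P̄ = Peeling F (complement-isInstance I)
  module L = P.Layer (P.densityVector-layer ρ-peel u)
  module L̄ = P̄.Layer (P̄.densityVector-layer ρ̄-peel u)
  r = L.value
  r̄ = L̄.value
  1≤r̄r : 1# ≤ r̄ * r
  1≤r̄r = 1≤slope-product (g-strict _ _ (p⊂p∪q L.u∉lower (x∉p⇒x∈∁p L̄.u∉lower))) L̄.value-nonneg
    (L.lower-maximizer _)
    (maximizer-≤-∪ (dualExcess-supermodular f-super g-sub L̄.value-nonneg)
                   (complement-maximizer L̄.lower-maximizer) L.lower)
  r̄r≤1 : r̄ * r ≤ 1#
  r̄r≤1 = slope-product≤1 (g-strict _ _ (p⊂p∪q (x∈p⇒x∉∁p L̄.u∈upper) L.u∈upper)) L̄.value-nonneg
    (maximizer-≤-∪ (P.excess-supermodular L.value-nonneg) L.upper-maximizer (∁ L̄.upper))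
    (complement-maximizer L̄.upper-maximizer _)
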